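{- Let $k\geq1$, let $G_i=(V_i,E_i)$ ($1\le i\le k$) and $H=(V_H,E_H)$ be pairwise vertex-disjoint, connected graphs, each with at least two vertices, let $u_i\in V_i$ and $v_1,\dots,v_k\in V_H$ (not necessarily distinct), and let $J=G_{1,\ldots,k}\circ^{u_1,\dots,u_k}_{v_1,\dots,v_k}H$. Then none of the vertices $v_1,\dots,v_k$ has an incident edge in the strong resolving graph $\mathrm{SR}(J)$.
   Context: All graphs are finite, undirected and simple. In a connected graph $G$, $d_G(x,y)$ is the distance and $N_G(x)$ the set of neighbours of $x$. A vertex $u$ is maximally distant from a vertex $w$ in $G$ if there is no $v\in N_G(u)$ with $d_G(v,w)>d_G(u,w)$. Two vertices are mutually maximally distant if each is maximally distant from the other. The strong resolving graph $\mathrm{SR}(G)$ has the same vertex set as $G$, with an edge between distinct $u,v$ iff they are mutually maximally distant in $G$. The composed graph $J=G_{1,\ldots,k}\circ^{u_1,\dots,u_k}_{v_1,\dots,v_k}H$ has vertex set $(V_1\cup\dots\cup V_k\cup V_H)\setminus\{u_1,\dots,u_k\}$ and edge set $(E_1\cup\dots\cup E_k\cup E_H\cup\{\{x,v_i\}: x\in N_{G_i}(u_i),1\le i\le k\})\setminus\{\{x,u_i\}: x\in N_{G_i}(u_i),1\le i\le k\}$; i.e. $J$ is obtained by identifying each $u_i$ with $v_i$. -}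

module Defs where

open import Data.Nat using (ℕ; zero; suc; _≤_; _<_)
open import Data.Fin using (Fin)
open import Data.Product using (Σ; ∃; _×_)
open import Relation.Nullary using (¬_)
open import Relation.Binary.PropositionalEquality using (_≡_; _≢_)

record Graph : Set₁ where
  field
    n     : ℕ
    Adj   : Fin n → Fin n → Set
    sym   : ∀ {x y} → Adj x y → Adj y x
    irrefl : ∀ {x} → ¬ Adj x x

V : Graph → Set
V G = Fin (Graph.n G)

data Walk {A : Set} (R : A → A → Set) : A → A → ℕ → Set where
  []  : ∀ {x} → Walk R x x zero
  _∷_ : ∀ {x y z m} → R x y → Walk R y z m → Walk R x z (suc m)

Connected : {A : Set} → (A → A → Set) → Set
Connected {A} R = (x y : A) → ∃ λ m → Walk R x y m

Dist : {A : Set} → (A → A → Set) → A → A → ℕ → Set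
Dist R x y d = Walk R x y d × (∀ m → Walk R x y m → d ≤ m)

MaxDistant : {A : Set} → (A → A → Set) → A → A → Set
MaxDistant {A} R u w =
  ¬ (Σ A λ v → R u v × Σ ℕ λ dv → Σ ℕ λ du → Dist R v w dv × Dist R u w du × du < dv)

MutuallyMaxDistant : {A : Set} → (A → A → Set) → A → A → Set
MutuallyMaxDistant R u v = MaxDistant R u v × MaxDistant R v u

SRAdj : {A : Set} → (A → A → Set) → A → A → Set
SRAdj R u v = u ≢ v × MutuallyMaxDistant R u v

-- Vertex set of J = G_{1..k} ∘^{u_1..u_k}_{v_1..v_k} H :
-- (V_1 ⊔ ... ⊔ V_k ⊔ V_H) \ {u_1,...,u_k}  (disjoint union, so the graphs are
-- pairwise vertex-disjoint by construction).
data VJ {k : ℕ} (G : Fin k → Graph) (H : Graph) (u : (i : Fin k) → V (G i)) : Set where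
  gv : (i : Fin k) (x : V (G i)) → .(x ≢ u i) → VJ G H u
  hv : V H → VJ G H u

data AdjJ {k : ℕ} (G : Fin k → Graph) (H : Graph) (u : (i : Fin k) → V (G i))
          (v : Fin k → V H) : VJ G H u → VJ G H u → Set where
  inG   : ∀ i x y .(px : x ≢ u i) .(py : y ≢ u i) → Graph.Adj (G i) x y →
          AdjJ G H u v (gv i x px) (gv i y py)
  inH   : ∀ a b → Graph.Adj H a b → AdjJ G H u v (hv a) (hv b)
  glueˡ : ∀ i x .(px : x ≢ u i) → Graph.Adj (G i) x (u i) →
          AdjJ G H u v (gv i x px) (hv (v i))
  glueʳ : ∀ i x .(px : x ≢ u i) → Graph.Adj (G i) x (u i) →
          AdjJ G H u v (hv (v i)) (gv i x px)

{-# OPTIONS --safe #-}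
module Submission where

-- v i is a cut vertex of J separating the copy of G i from the rest of J.
-- Given y, pick a neighbour w' of v i on the other side of that cut: an
-- H-neighbour of v i if y lies in the copy of G i, and a G i-neighbour of
-- u i otherwise.  Every walk from w' to y then passes through v i, so
-- d(w', y) > d(v i, y) and v i is not even maximally distant from y.

open import Defs
open import Data.Nat using (ℕ; suc; _+_; _≤_; _<_; s≤s)
open import Data.Nat.Properties using (≤-refl; ≤-trans; ≮⇒≥; m≤n⇒m≤1+n)
open import Data.Nat.Induction using (<-rec)
open import Data.Fin using (Fin; _≟_; punchIn) renaming (zero to fzero)
open import Data.Fin.Properties using (punchInᵢ≢i)
open import Data.Product using (Σ; ∃; _×_; _,_; proj₂)
open import Data.Empty using (⊥; ⊥-elim; ⊥-elim-irr)
open import Relation.Nullary using (¬_; Dec; yes; no)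
open import Relation.Binary.PropositionalEquality using (_≡_; _≢_; refl; sym; subst)

-- Walks need not be decidable, so shortest ones exist only up to double
-- negation; this suffices since every goal below is a negation.
¬¬-least : {P : ℕ → Set} {m : ℕ} → P m → ¬ ¬ Σ ℕ (λ d → P d × (∀ j → P j → d ≤ j))
¬¬-least {P} {m} pm no-least = <-rec (λ n → ¬ P n) least-or-absent m pm
  where
  least-or-absent : ∀ n → (∀ {j} → j < n → ¬ P j) → ¬ P n
  least-or-absent n below pn = no-least (n , pn , λ j pj → ≮⇒≥ (λ j<n → below j<n pj))

module _ {A : Set} (R : A → A → Set) where

  Walk≤ : A → A → ℕ → Set
  Walk≤ x y m = ∃ λ m' → m' ≤ m × Walk R x y m'

  Walk< : A → A → ℕ → Set
  Walk< x y m = ∃ λ m' → m' < m × Walk R x y m'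

module _ {A : Set} {R : A → A → Set} where

  _++ʷ_ : ∀ {x y z m n} → Walk R x y m → Walk R y z n → Walk R x z (m + n)
  [] ++ʷ q = q
  (e ∷ p) ++ʷ q = e ∷ (p ++ʷ q)

  map-walk : {B : Set} {S : B → B → Set} (f : A → B) → (∀ {x y} → R x y → S (f x) (f y)) →
             ∀ {x y m} → Walk R x y m → Walk S (f x) (f y) m
  map-walk f f-edge [] = []
  map-walk f f-edge (e ∷ p) = f-edge e ∷ map-walk f f-edge p

  first-step : ∀ {x y m} → Walk R x y m → x ≢ y → ∃ (R x)
  first-step [] x≢x = ⊥-elim (x≢x refl)
  first-step (e ∷ _) _ = _ , e

  ¬¬-dist : ∀ {x y m} → Walk R x y m → ¬ ¬ Σ ℕ (Dist R x y)
  ¬¬-dist = ¬¬-least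

  Walk≤-suc : ∀ {x y m} → Walk≤ R x y m → Walk≤ R x y (suc m)
  Walk≤-suc (m' , m'≤m , walk) = m' , m≤n⇒m≤1+n m'≤m , walk

  Walk<-suc : ∀ {x y m} → Walk< R x y m → Walk< R x y (suc m)
  Walk<-suc (m' , m'<m , walk) = m' , m≤n⇒m≤1+n m'<m , walk

  Walk≤⇒Walk<-suc : ∀ {x y m} → Walk≤ R x y m → Walk< R x y (suc m)
  Walk≤⇒Walk<-suc (m' , m'≤m , walk) = m' , s≤s m'≤m , walk

  ¬maxDistant-by-detour : ∀ {w w' y} → R w w' → (∃ λ m → Walk R w' y m) →
                          (∀ {m} → Walk R w' y m → Walk< R w y m) → ¬ MaxDistant R w y
  ¬maxDistant-by-detour {w} {w'} {y} e (_ , w'y) detour maxDistant with detour w'y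
  ... | _ , _ , wy =
    ¬¬-dist w'y λ { (dv , Dv) → ¬¬-dist wy λ { (du , Du) →
      maxDistant (w' , e , dv , du , Dv , Du , closer Du Dv) } }
    where
    closer : ∀ {du dv} → Dist R w y du → Dist R w' y dv → du < dv
    closer (_ , minimal) (shortest , _) with detour shortest
    ... | m' , m'<dv , wy' = ≤-trans (s≤s (minimal m' wy')) m'<dv

≢-of-adj : (G : Graph) {x y : V G} → Graph.Adj G x y → x ≢ y
≢-of-adj G xy refl = Graph.irrefl G xy

neighbour : (G : Graph) → Connected (Graph.Adj G) → 2 ≤ Graph.n G →
            (a : V G) → ∃ (Graph.Adj G a)
neighbour G conn (s≤s (s≤s _)) a =
  first-step (proj₂ (conn a (punchIn a fzero))) (λ a≡b → punchInᵢ≢i a fzero (sym a≡b))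

module Composed {k : ℕ} (G : Fin k → Graph) (H : Graph)
                (u : (i : Fin k) → V (G i)) (v : Fin k → V H) where

  R : VJ G H u → VJ G H u → Set
  R = AdjJ G H u v

  embed : ∀ j → V (G j) → VJ G H u
  embed j z with z ≟ u j
  ... | yes _ = hv (v j)
  ... | no z≢u = gv j z z≢u

  embed-edge : ∀ j {z z'} → Graph.Adj (G j) z z' → R (embed j z) (embed j z')
  embed-edge j {z} {z'} e with z ≟ u j | z' ≟ u j
  ... | yes refl | yes refl = ⊥-elim (Graph.irrefl (G j) e)
  ... | yes refl | no z'≢u = glueʳ j z' z'≢u (Graph.sym (G j) e)
  ... | no z≢u | yes refl = glueˡ j z z≢u e
  ... | no z≢u | no z'≢u = inG j z z' z≢u z'≢u e

  embed-glued : ∀ j → embed j (u j) ≡ hv (v j)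
  embed-glued j with u j ≟ u j
  ... | yes _ = refl
  ... | no u≢u = ⊥-elim (u≢u refl)

  embed-unglued : ∀ j z .(z≢u : z ≢ u j) → embed j z ≡ gv j z z≢u
  embed-unglued j z z≢u with z ≟ u j
  ... | yes z≡u = ⊥-elim-irr (z≢u z≡u)
  ... | no _ = refl

  lift-H : ∀ {a b m} → Walk (Graph.Adj H) a b m → Walk R (hv a) (hv b) m
  lift-H = map-walk hv (inH _ _)

  lift-G : ∀ j {z m} .(z≢u : z ≢ u j) → Walk (Graph.Adj (G j)) (u j) z m →
           Walk R (hv (v j)) (gv j z z≢u) m
  lift-G j {z} {m} z≢u walk =
    subst (λ t → Walk R t (gv j z z≢u) m) (embed-glued j)
      (subst (λ t → Walk R (embed j (u j)) t m) (embed-unglued j z z≢u)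
        (map-walk (embed j) (embed-edge j) walk))

  connected-from-H : (∀ j → Connected (Graph.Adj (G j))) → Connected (Graph.Adj H) →
                     ∀ a y → ∃ λ m → Walk R (hv a) y m
  connected-from-H cG cH a (hv b) with cH a b
  ... | m , ab = m , lift-H ab
  connected-from-H cG cH a (gv j z z≢u) with cH a (v j) | cG j (u j) z
  ... | m , avj | m' , uz = m + m' , lift-H avj ++ʷ lift-G j z≢u uz

  module _ (i : Fin k) where

    InCopy : VJ G H u → Set
    InCopy (gv j _ _) = j ≡ i
    InCopy (hv _) = ⊥

    leave-copy : ∀ {p q m} → Walk R p q m → InCopy p → ¬ InCopy q → Walk< R (hv (v i)) q m
    leave-copy [] p∈ q∉ = ⊥-elim (q∉ p∈)
    leave-copy (inG _ _ _ _ _ _ ∷ rest) p∈ q∉ = Walk<-suc (leave-copy rest p∈ q∉)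
    leave-copy (glueˡ _ _ _ _ ∷ rest) refl q∉ = _ , ≤-refl , rest

    enter-copy : ∀ {p q m} → Walk R p q m → ¬ InCopy p → InCopy q → Walk≤ R (hv (v i)) q m
    enter-copy [] p∉ q∈ = ⊥-elim (p∉ q∈)
    enter-copy (inG _ _ _ _ _ _ ∷ rest) p∉ q∈ = Walk≤-suc (enter-copy rest p∉ q∈)
    enter-copy (inH _ _ _ ∷ rest) p∉ q∈ = Walk≤-suc (enter-copy rest (λ ()) q∈)
    enter-copy (glueˡ _ _ _ _ ∷ rest) p∉ q∈ = Walk≤-suc (enter-copy rest (λ ()) q∈)
    enter-copy walk@(glueʳ j _ _ _ ∷ rest) p∉ q∈ with j ≟ i
    ... | yes refl = _ , ≤-refl , walk
    ... | no j≢i = Walk≤-suc (enter-copy rest j≢i q∈)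

    enter-copy-from-neighbour : ∀ {h q m} → Graph.Adj H (v i) h → Walk R (hv h) q m →
                                InCopy q → Walk< R (hv (v i)) q m
    enter-copy-from-neighbour e [] ()
    enter-copy-from-neighbour e (inH _ _ _ ∷ rest) q∈ = Walk≤⇒Walk<-suc (enter-copy rest (λ ()) q∈)
    enter-copy-from-neighbour e (glueʳ j _ _ _ ∷ rest) q∈ with j ≟ i
    ... | yes refl = ⊥-elim (Graph.irrefl H e)
    ... | no j≢i = Walk≤⇒Walk<-suc (enter-copy rest j≢i q∈)

    in-copy? : ∀ y → Dec (InCopy y)
    in-copy? (gv j _ _) = j ≟ i
    in-copy? (hv _) = no λ ()

    hub-not-maxDistant : (∀ j → Connected (Graph.Adj (G j))) → (∀ j → 2 ≤ Graph.n (G j)) →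
                         Connected (Graph.Adj H) → 2 ≤ Graph.n H →
                         ∀ y → ¬ MaxDistant R (hv (v i)) y
    hub-not-maxDistant cG nG cH nH y = across-the-cut (in-copy? y)
      where
      across-the-cut : Dec (InCopy y) → ¬ MaxDistant R (hv (v i)) y
      across-the-cut (yes y∈) with neighbour H cH nH (v i)
      ... | h , vh = ¬maxDistant-by-detour (inH _ _ vh) (connected-from-H cG cH h y)
                       λ walk → enter-copy-from-neighbour vh walk y∈
      across-the-cut (no y∉) with neighbour (G i) (cG i) (nG i) (u i) | connected-from-H cG cH (v i) y
      ... | x , ux | _ , v-to-y = ¬maxDistant-by-detour (glueʳ i x x≢u xu) (_ , glueˡ i x x≢u xu ∷ v-to-y)
                       λ walk → leave-copy walk refl y∉
        where
        xu : Graph.Adj (G i) x (u i)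
        xu = Graph.sym (G i) ux
        x≢u : x ≢ u i
        x≢u = ≢-of-adj (G i) xu

lemma1 : (k : ℕ) → 1 ≤ k →
    (G : Fin k → Graph) (H : Graph) →
    (∀ i → Connected (Graph.Adj (G i))) → (∀ i → 2 ≤ Graph.n (G i)) →
    Connected (Graph.Adj H) → 2 ≤ Graph.n H →
    (u : (i : Fin k) → V (G i)) (v : Fin k → V H) →
    ∀ i (y : VJ G H u) → ¬ SRAdj (AdjJ G H u v) (hv (v i)) y
lemma1 k _ G H cG nG cH nH u v i y (_ , hub-maxDistant , _) =
  Composed.hub-not-maxDistant G H u v i cG nG cH nH y hub-maxDistant
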